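{- Let $G$ be a finite cubic bridgeless graph embedded in the plane, with edge set $E$, and let $\mathfrak{d}(G)$ be its weak Hamiltonian graph. Then: (1) for any two adjacent vertices $h_1,h_2$ of $\mathfrak{d}(G)$ there is a third vertex $h_3$ adjacent to both $h_1$ and $h_2$ such that $h_1+h_2+h_3=0$ in $\mathbb{F}_2^{|E|}$ (identifying each weak Hamiltonian with the indicator vector of its edge set); (2) every vertex of $\mathfrak{d}(G)$ belongs to a $3$-vertex clique of this form (a chromatic clique); (3) the degree in $\mathfrak{d}(G)$ of a vertex is $2^{N}$, where $N$ is the number of cycles of the corresponding weak Hamiltonian.
   Context: A weak Hamiltonian of a cubic graph $G$ is a $2$-factor of $G$ all of whose cycles have even length. For a weak Hamiltonian $C$ with cycles $C_1,\ldots,C_N$, let $C^{\perp}$ be the set of edges of $G$ not in $C$; for a choice of a $1$-factor (perfect matching) $F_i$ of each $C_i$, the $(F_1,\ldots,F_N)$ mutation of $C$ is the spanning subgraph with edge set $C^{\perp}\cup F_1\cup\cdots\cup F_N$. The weak Hamiltonian graph $\mathfrak{d}(G)$ has as vertices the weak Hamiltonians of $G$, two vertices being joined by an edge when the corresponding weak Hamiltonians are related by a mutation (one is a mutation of the other). -}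

module Defs where

open import Data.Nat using (ℕ; zero; suc; _+_; _*_; _^_; _<_)
open import Data.Bool using (Bool; true; false; _∧_; _∨_; _xor_; not; if_then_else_)
open import Data.Fin using (Fin; _≟_)
open import Data.Fin.Subset using (Subset)
open import Data.Vec using (Vec; lookup; zipWith; replicate; map; tabulate)
open import Data.List using (List; length; allFin)
open import Data.Nat.ListAction using (sum)
import Data.List as List
open import Data.List.Membership.Propositional using (_∈_)
open import Data.List.Relation.Unary.AllPairs using (AllPairs)
open import Data.List.Relation.Unary.Unique.Propositional using (Unique)
open import Data.Product using (Σ; ∃; ∃-syntax; _×_; _,_; proj₁; proj₂)
open import Data.Sum using (_⊎_)
open import Relation.Nullary using (¬_)
open import Relation.Nullary.Decidable using (⌊_⌋)
open import Relation.Binary.PropositionalEquality using (_≡_; _≢_)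
open import Function.Bundles using (_⇔_)

HasSize : {A : Set} → (A → Set) → ℕ → Set
HasSize {A} P k = Σ (List A) λ L → Unique L × (∀ x → (x ∈ L) ⇔ P x) × length L ≡ k

NumClasses : {A : Set} → (A → A → Set) → ℕ → Set
NumClasses {A} R k =
  Σ (List A) λ L → AllPairs (λ x y → ¬ R x y) L × (∀ a → ∃[ x ] (x ∈ L × R x a)) × length L ≡ k

iter : {A : Set} → (A → A) → ℕ → A → A
iter f zero    a = a
iter f (suc k) a = f (iter f k a)

Even : ℕ → Set
Even k = ∃[ j ] k ≡ 2 * j

-- Finite (multi)graphs: vertices Fin n, edges Fin m, each edge has two
-- distinct endpoints (no loops; parallel edges allowed).

record Graph (n m : ℕ) : Set where
  field
    ends     : Fin m → Fin n × Fin n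
    loopless : ∀ e → proj₁ (ends e) ≢ proj₂ (ends e)

module _ {n m : ℕ} (G : Graph n m) where
  open Graph G

  -- edge sets = subsets of E, i.e. indicator vectors in 𝔽₂^|E|
  EdgeSet : Set
  EdgeSet = Subset m

  allEdges : EdgeSet
  allEdges = replicate m true

  complement : EdgeSet → EdgeSet
  complement = map not

  _∪ₑ_ : EdgeSet → EdgeSet → EdgeSet
  _∪ₑ_ = zipWith _∨_

  _+₂_ : EdgeSet → EdgeSet → EdgeSet
  _+₂_ = zipWith _xor_

  zero₂ : EdgeSet
  zero₂ = replicate m false

  _⊆ₑ_ : EdgeSet → EdgeSet → Set
  S ⊆ₑ T = ∀ e → lookup S e ≡ true → lookup T e ≡ true

  incident : Fin m → Fin n → Bool
  incident e v = ⌊ proj₁ (ends e) ≟ v ⌋ ∨ ⌊ proj₂ (ends e) ≟ v ⌋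

  degIn : EdgeSet → Fin n → ℕ
  degIn S v = sum (List.map (λ e → if lookup S e ∧ incident e v then 1 else 0) (allFin m))

  Joins : Fin m → Fin n → Fin n → Set
  Joins e u w = (ends e ≡ (u , w)) ⊎ (ends e ≡ (w , u))

  data Reach (S : EdgeSet) : Fin n → Fin n → Set where
    here : ∀ {u} → Reach S u u
    step : ∀ {u w v} e → lookup S e ≡ true → Joins e u w → Reach S w v → Reach S u v

  Cubic : Set
  Cubic = ∀ v → degIn allEdges v ≡ 3

  Bridgeless : Set
  Bridgeless = ∀ e → Reach (tabulate λ f → not ⌊ f ≟ e ⌋) (proj₁ (ends e)) (proj₂ (ends e))

  Connected-in : EdgeSet → Fin n → Fin n → Set
  Connected-in = Reach

  -- Plane embeddings, combinatorially: rotation systems of genus 0.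
  -- A dart is an edge with a chosen end; a rotation system is a
  -- permutation σ of darts whose orbits are exactly the sets of darts at
  -- each vertex; faces are the orbits of σ ∘ α (α reverses a dart).
  -- The embedding is plane iff Euler's formula V - E + F = 2 holds on
  -- every component, i.e. V + F = E + 2·(number of components).

  Dart : Set
  Dart = Fin m × Bool

  tail : Dart → Fin n
  tail (e , true)  = proj₁ (ends e)
  tail (e , false) = proj₂ (ends e)

  α : Dart → Dart
  α (e , b) = (e , not b)

  Orbit : (Dart → Dart) → Dart → Dart → Set
  Orbit f d d' = ∃[ k ] iter f k d ≡ d'

  record RotationSystem : Set where
    field
      σ      : Dart → Dart
      σ⁻¹    : Dart → Dart
      inv₁   : ∀ d → σ (σ⁻¹ d) ≡ d
      inv₂   : ∀ d → σ⁻¹ (σ d) ≡ d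
      σ-tail : ∀ d → tail (σ d) ≡ tail d
      σ-cyc  : ∀ d d' → tail d ≡ tail d' → Orbit σ d d'

    φ : Dart → Dart
    φ d = σ (α d)

  PlaneEmbedding : Set
  PlaneEmbedding =
    Σ RotationSystem λ ρ → ∃[ f ] ∃[ c ]
      (NumClasses (Orbit (RotationSystem.φ ρ)) f ×
       NumClasses (Reach allEdges) c ×
       n + f ≡ m + 2 * c)

  -- spanning 2-regular subgraph (its cycles = its connected components)
  TwoFactor : EdgeSet → Set
  TwoFactor C = ∀ v → degIn C v ≡ 2

  -- every cycle (component) of C has even length (= number of vertices)
  EvenCycles : EdgeSet → Set
  EvenCycles C = ∀ v → ∃[ k ] (HasSize (Reach C v) k × Even k)

  WeakHamiltonian : EdgeSet → Set
  WeakHamiltonian C = TwoFactor C × EvenCycles C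

  NumCycles : EdgeSet → ℕ → Set
  NumCycles C N = NumClasses (Reach C) N

  -- D is a mutation of C: D = C^⊥ ∪ F₁ ∪ … ∪ F_N where F = F₁ ∪ … ∪ F_N
  -- is a 1-factor of the 2-factor C (a choice of a 1-factor Fᵢ of
  -- every cycle Cᵢ is the same as a 1-factor F ⊆ C of (V, C)).
  Mutation : EdgeSet → EdgeSet → Set
  Mutation C D = Σ EdgeSet λ F →
    (F ⊆ₑ C) × (∀ v → degIn F v ≡ 1) × (D ≡ complement C ∪ₑ F)

  Adj𝔡 : EdgeSet → EdgeSet → Set
  Adj𝔡 h₁ h₂ = Mutation h₁ h₂ ⊎ Mutation h₂ h₁

  ChromaticClique : EdgeSet → EdgeSet → EdgeSet → Set
  ChromaticClique h₁ h₂ h₃ =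
    WeakHamiltonian h₁ × WeakHamiltonian h₂ × WeakHamiltonian h₃ ×
    h₁ ≢ h₂ × h₁ ≢ h₃ × h₂ ≢ h₃ ×
    Adj𝔡 h₁ h₂ × Adj𝔡 h₁ h₃ × Adj𝔡 h₂ h₃ ×
    (h₁ +₂ h₂) +₂ h₃ ≡ zero₂

  Degree𝔡 : EdgeSet → ℕ → Set
  Degree𝔡 h d = HasSize (λ h' → WeakHamiltonian h' × Adj𝔡 h h') d

module Submission where

-- A weak Hamiltonian C of a cubic graph leaves a perfect matching C^⊥, so a mutation
-- D = C^⊥ ∪ F is again a 2-factor, and its cycles alternate between edges of C^⊥ and of F;
-- hence they are even and D is a weak Hamiltonian. Mutating C by F and by its complement
-- C ∖ F in C gives h₂ and h₃ with C + h₂ + h₃ = 0, and h₃ is also the mutation of h₂ by C^⊥: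
-- a chromatic clique. Walking around an even cycle and taking every other edge gives a
-- 1-factor of C; any other 1-factor of C agrees with it or with its complement on each cycle,
-- so the mutations of C are in bijection with the 2^N ways of flipping a subset of the N cycles,
-- and as mutation is symmetric these are all the neighbours of C.

open import Defs
open import Data.Bool using (Bool; true; false; _∧_; _∨_; _xor_; not; if_then_else_)
import Data.Bool as Bool
open import Data.Bool.Properties
  using (not-involutive; xor-annihilates-not; not-distribˡ-xor; not-distribʳ-xor; xor-same; xor-identityʳ; xor-comm; ∧-zeroʳ; ∧-identityʳ; ∨-zeroʳ)
open import Data.Empty using (⊥-elim)
open import Data.Fin as Fin using (Fin; _≟_; toℕ)
import Data.Fin.Properties as Finₚ
open import Data.List as List using (List; []; _∷_; _++_; length; allFin; filter; applyUpTo)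
open import Data.List.Properties using (length-++; length-map; length-applyUpTo; map-cong; filter-≐)
open import Data.List.Membership.Propositional using (_∈_)
open import Data.List.Membership.Propositional.Properties
  using (∈-allFin; ∈-lookup; ∈-filter⁺; ∈-filter⁻; ∈-applyUpTo⁺; ∈-applyUpTo⁻; ∈-∃++; ∈-++⁻; ∈-++⁺ˡ; ∈-++⁺ʳ; ∈-map⁺; ∈-map⁻)
open import Data.List.Relation.Unary.Any as Any using (here; there)
open import Data.List.Relation.Unary.Any.Properties using (lookup-index)
import Data.List.Relation.Unary.All as All
open import Data.List.Relation.Unary.AllPairs using (AllPairs; []; _∷_)
import Data.List.Relation.Unary.AllPairs as AllPairs
open import Data.List.Relation.Unary.Unique.Propositional using (Unique)
import Data.List.Relation.Unary.Unique.Propositional.Properties as Uniqueₚ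
open import Data.Nat using (ℕ; zero; suc; _+_; _*_; _∸_; _^_; _<_; _≤_; z≤n; s≤s; _<?_; NonZero; >-nonZero; pred; _%_; _/_)
open import Data.Nat.Properties hiding (_≟_)
open import Data.Nat.DivMod using (m≡m%n+[m/n]*n; m%n<n)
open import Data.Nat.Induction using (<-rec)
open import Data.Nat.ListAction using (sum)
open import Algebra.Properties.CommutativeSemigroup +-commutativeSemigroup using (interchange)
open import Data.Product using (∃-syntax; _×_; _,_; proj₁; proj₂)
import Data.Product.Properties as Productₚ
open import Data.Sum using (_⊎_; inj₁; inj₂)
open import Data.Vec as Vec using (Vec; lookup; tabulate)
open import Data.Vec.Properties
  using (lookup-zipWith; lookup-map; lookup-replicate; lookup∘tabulate; tabulate∘lookup; tabulate-cong; ∷-injectiveʳ)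
open import Function.Bundles using (_⇔_; mk⇔; Equivalence)
open import Relation.Nullary using (¬_; yes; no; Dec; does)
open import Relation.Nullary.Decidable using (⌊_⌋; _×-dec_; dec-true; dec-false)
open import Relation.Binary.Definitions using (tri<; tri≈; tri>)
open import Relation.Binary.PropositionalEquality

bit : Bool → ℕ
bit b = if b then 1 else 0

bit+bit≡1⇒≡not : ∀ a b → bit a + bit b ≡ 1 → b ≡ not a
bit+bit≡1⇒≡not true  false _ = refl
bit+bit≡1⇒≡not false true  _ = refl
bit+bit≡1⇒≡not true  true  ()
bit+bit≡1⇒≡not false false ()

bit³≡2 : ∀ a b c → bit a + (bit b + (bit c + 0)) ≡ 2 →
  (a ≡ true × b ≡ true × c ≡ false) ⊎ (a ≡ true × b ≡ false × c ≡ true) ⊎ (a ≡ false × b ≡ true × c ≡ true)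
bit³≡2 true  true  false _ = inj₁ (refl , refl , refl)
bit³≡2 true  false true  _ = inj₂ (inj₁ (refl , refl , refl))
bit³≡2 false true  true  _ = inj₂ (inj₂ (refl , refl , refl))
bit³≡2 true  true  true  ()
bit³≡2 true  false false ()
bit³≡2 false true  false ()
bit³≡2 false false true  ()
bit³≡2 false false false ()

∧-true⇒ˡ : ∀ a {b} → a ∧ b ≡ true → a ≡ true
∧-true⇒ˡ true _ = refl

xor-cancelˡ : ∀ x {y z} → x xor y ≡ x xor z → y ≡ z
xor-cancelˡ false eq = eq
xor-cancelˡ true {y} {z} eq = trans (sym (not-involutive y)) (trans (cong not eq) (not-involutive z))

module _ {A : Set} where

  sum-map-ones : (xs : List A) → sum (List.map (λ _ → 1) xs) ≡ length xs
  sum-map-ones []       = refl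
  sum-map-ones (_ ∷ xs) = cong suc (sum-map-ones xs)

  sum-map-bit-∧ : (f g : A → Bool) (xs : List A) →
    sum (List.map (λ x → bit (f x ∧ g x)) xs) ≡ sum (List.map (λ x → bit (f x)) (filter (λ x → g x Bool.≟ true) xs))
  sum-map-bit-∧ f g [] = refl
  sum-map-bit-∧ f g (x ∷ xs) with g x
  ... | false = trans (cong (λ b → bit b + _) (∧-zeroʳ (f x))) (sum-map-bit-∧ f g xs)
  ... | true  = cong₂ _+_ (cong bit (∧-identityʳ (f x))) (sum-map-bit-∧ f g xs)

  sum-map-linear : (f g h k : A → ℕ) → (∀ x → f x + g x ≡ h x + k x) → ∀ xs →
    sum (List.map f xs) + sum (List.map g xs) ≡ sum (List.map h xs) + sum (List.map k xs)
  sum-map-linear f g h k eq [] = refl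
  sum-map-linear f g h k eq (x ∷ xs) = begin
    (f x + sum (List.map f xs)) + (g x + sum (List.map g xs)) ≡⟨ interchange (f x) _ (g x) _ ⟩
    (f x + g x) + (sum (List.map f xs) + sum (List.map g xs)) ≡⟨ cong₂ _+_ (eq x) (sum-map-linear f g h k eq xs) ⟩
    (h x + k x) + (sum (List.map h xs) + sum (List.map k xs)) ≡⟨ interchange (h x) (k x) _ _ ⟩
    (h x + sum (List.map h xs)) + (k x + sum (List.map k xs)) ∎
    where open ≡-Reasoning

  sum-map-bit≡suc⇒∃ : (f : A → Bool) (xs : List A) {k : ℕ} → sum (List.map (λ x → bit (f x)) xs) ≡ suc k → ∃[ x ] f x ≡ true
  sum-map-bit≡suc⇒∃ f (x ∷ xs) eq with f x in fx
  ... | true  = x , fx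
  ... | false = sum-map-bit≡suc⇒∃ f xs eq

  Unique⇒length≤ : {xs ys : List A} → Unique xs → (∀ {x} → x ∈ xs → x ∈ ys) → length xs ≤ length ys
  Unique⇒length≤ {[]} _ _ = z≤n
  Unique⇒length≤ {x ∷ xs} {ys} (x∉xs ∷ uxs) xs⊆ys with ∈-∃++ (xs⊆ys (here refl))
  ... | ys₁ , ys₂ , refl = begin
    suc (length xs)               ≤⟨ s≤s (Unique⇒length≤ uxs xs⊆ys₁ys₂) ⟩
    suc (length (ys₁ ++ ys₂))     ≡⟨ cong suc (length-++ ys₁) ⟩
    suc (length ys₁ + length ys₂) ≡⟨ +-suc (length ys₁) (length ys₂) ⟨
    length ys₁ + suc (length ys₂) ≡⟨ length-++ ys₁ ⟨
    length (ys₁ ++ x ∷ ys₂)       ∎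
    where
    open ≤-Reasoning
    xs⊆ys₁ys₂ : ∀ {y} → y ∈ xs → y ∈ ys₁ ++ ys₂
    xs⊆ys₁ys₂ {y} y∈xs with ∈-++⁻ ys₁ (xs⊆ys (there y∈xs))
    ... | inj₁ y∈ys₁          = ∈-++⁺ˡ y∈ys₁
    ... | inj₂ (here refl)    = ⊥-elim (All.lookup x∉xs y∈xs refl)
    ... | inj₂ (there y∈ys₂)  = ∈-++⁺ʳ ys₁ y∈ys₂

  Unique⇒length≡ : {xs ys : List A} → Unique xs → Unique ys → (∀ x → x ∈ xs ⇔ x ∈ ys) → length xs ≡ length ys
  Unique⇒length≡ uxs uys xs≈ys = ≤-antisym
    (Unique⇒length≤ uxs (Equivalence.to (xs≈ys _)))
    (Unique⇒length≤ uys (Equivalence.from (xs≈ys _)))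

  AllPairs-lookup : {R : A → A → Set} {xs : List A} → AllPairs R xs →
    ∀ i j → toℕ i < toℕ j → R (List.lookup xs i) (List.lookup xs j)
  AllPairs-lookup (Rx ∷ _)   Fin.zero    (Fin.suc j) _         = All.lookup Rx (∈-lookup j)
  AllPairs-lookup (_  ∷ Rxs) (Fin.suc i) (Fin.suc j) (s≤s i<j) = AllPairs-lookup Rxs i j i<j

lookup-extensionality : ∀ {A : Set} {k} {xs ys : Vec A k} → (∀ i → lookup xs i ≡ lookup ys i) → xs ≡ ys
lookup-extensionality {xs = xs} {ys} eq = trans (sym (tabulate∘lookup xs)) (trans (tabulate-cong eq) (tabulate∘lookup ys))

allBoolVecs : ∀ k → List (Vec Bool k)
allBoolVecs zero    = Vec.[] ∷ []
allBoolVecs (suc k) = List.map (true Vec.∷_) (allBoolVecs k) ++ List.map (false Vec.∷_) (allBoolVecs k)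

length-allBoolVecs : ∀ k → length (allBoolVecs k) ≡ 2 ^ k
length-allBoolVecs zero    = refl
length-allBoolVecs (suc k) = begin
  length (List.map (true Vec.∷_) (allBoolVecs k) ++ List.map (false Vec.∷_) (allBoolVecs k))
    ≡⟨ length-++ (List.map (true Vec.∷_) (allBoolVecs k)) ⟩
  length (List.map (true Vec.∷_) (allBoolVecs k)) + length (List.map (false Vec.∷_) (allBoolVecs k))
    ≡⟨ cong₂ _+_ (length-map _ (allBoolVecs k)) (length-map _ (allBoolVecs k)) ⟩
  length (allBoolVecs k) + length (allBoolVecs k)
    ≡⟨ cong₂ _+_ (length-allBoolVecs k) (trans (length-allBoolVecs k) (sym (+-identityʳ (2 ^ k)))) ⟩
  2 ^ suc k ∎
  where open ≡-Reasoning

∈-allBoolVecs : ∀ k (b : Vec Bool k) → b ∈ allBoolVecs k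
∈-allBoolVecs zero    Vec.[]         = here refl
∈-allBoolVecs (suc k) (true Vec.∷ b)  = ∈-++⁺ˡ (∈-map⁺ (true Vec.∷_) (∈-allBoolVecs k b))
∈-allBoolVecs (suc k) (false Vec.∷ b) =
  ∈-++⁺ʳ (List.map (true Vec.∷_) (allBoolVecs k)) (∈-map⁺ (false Vec.∷_) (∈-allBoolVecs k b))

allBoolVecs-unique : ∀ k → Unique (allBoolVecs k)
allBoolVecs-unique zero    = All.[] ∷ []
allBoolVecs-unique (suc k) = Uniqueₚ.++⁺
  (Uniqueₚ.map⁺ ∷-injectiveʳ (allBoolVecs-unique k)) (Uniqueₚ.map⁺ ∷-injectiveʳ (allBoolVecs-unique k)) disjoint
  where
  disjoint : ∀ {b} → ¬ (b ∈ List.map (true Vec.∷_) (allBoolVecs k) × b ∈ List.map (false Vec.∷_) (allBoolVecs k))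
  disjoint (t , f) with ∈-map⁻ (true Vec.∷_) t | ∈-map⁻ (false Vec.∷_) f
  ... | _ , _ , refl | _ , _ , ()

least : ∀ {P : ℕ → Set} → (∀ k → Dec (P k)) → ∀ {n} → P n → ∃[ k ] (P k × (∀ {j} → j < k → ¬ P j))
least {P} P? {n} = <-rec (λ n → P n → ∃[ k ] (P k × (∀ {j} → j < k → ¬ P j))) search n
  where
  search : ∀ n → (∀ {j} → j < n → P j → ∃[ k ] (P k × (∀ {i} → i < k → ¬ P i))) →
           P n → ∃[ k ] (P k × (∀ {j} → j < k → ¬ P j))
  search n rec Pn with anyUpTo? P? n
  ... | yes (j , j<n , Pj) = rec j<n Pj
  ... | no ∄j              = n , Pn , λ j<n Pj → ∄j (_ , j<n , Pj)

odd : ℕ → Bool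
odd zero    = false
odd (suc k) = not (odd k)

odd-+ : ∀ a b → odd (a + b) ≡ odd a xor odd b
odd-+ zero    b = refl
odd-+ (suc a) b = trans (cong not (odd-+ a b)) (not-distribˡ-xor (odd a) (odd b))

odd-*-even : ∀ q {k} → odd k ≡ false → odd (q * k) ≡ false
odd-*-even zero        _  = refl
odd-*-even (suc q) {k} ek = trans (odd-+ k (q * k)) (cong₂ _xor_ ek (odd-*-even q ek))

Even⇒¬odd : ∀ k → Even k → odd k ≡ false
Even⇒¬odd _ (j , refl) = begin
  odd (j + (j + 0))       ≡⟨ odd-+ j (j + 0) ⟩
  odd j xor odd (j + 0)   ≡⟨ cong (λ i → odd j xor odd i) (+-identityʳ j) ⟩
  odd j xor odd j         ≡⟨ xor-same (odd j) ⟩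
  false                   ∎
  where open ≡-Reasoning

¬odd⇒Even : ∀ k → odd k ≡ false → Even k
¬odd⇒Even zero          _ = 0 , refl
¬odd⇒Even (suc (suc k)) e with ¬odd⇒Even k (trans (sym (not-involutive (odd k))) e)
... | j , refl = suc j , cong suc (sym (+-suc j (j + 0)))

iter-+ : ∀ {A : Set} (f : A → A) k j a → iter f (k + j) a ≡ iter f k (iter f j a)
iter-+ f zero    j a = refl
iter-+ f (suc k) j a = cong f (iter-+ f k j a)

<⇒≡+suc : ∀ {i j} → i < j → ∃[ d ] j ≡ i + suc d
<⇒≡+suc {zero}  {suc j} _         = j , refl
<⇒≡+suc {suc i} {suc j} (s≤s i<j) with <⇒≡+suc i<j
... | d , refl = d , refl

module _ {n m : ℕ} (G : Graph n m) where
  open Graph G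

  end₁ end₂ : Fin m → Fin n
  end₁ e = proj₁ (ends e)
  end₂ e = proj₂ (ends e)

  incident-end₁ : ∀ e → incident G e (end₁ e) ≡ true
  incident-end₁ e with end₁ e ≟ end₁ e
  ... | yes _  = refl
  ... | no ≢e  = ⊥-elim (≢e refl)

  incident-end₂ : ∀ e → incident G e (end₂ e) ≡ true
  incident-end₂ e with end₂ e ≟ end₂ e
  ... | yes _  = ∨-zeroʳ _
  ... | no ≢e  = ⊥-elim (≢e refl)

  incident⇒end : ∀ {e v} → incident G e v ≡ true → end₁ e ≡ v ⊎ end₂ e ≡ v
  incident⇒end {e} {v} e∋v with end₁ e ≟ v | end₂ e ≟ v
  ... | yes p | _     = inj₁ p
  ... | no _  | yes q = inj₂ q
  incident⇒end () | no _ | no _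

  Joins-sym : ∀ {e u w} → Joins G e u w → Joins G e w u
  Joins-sym (inj₁ p) = inj₂ p
  Joins-sym (inj₂ p) = inj₁ p

  Joins⇒incident : ∀ {e u w} → Joins G e u w → incident G e u ≡ true
  Joins⇒incident {e} (inj₁ p) = subst (λ x → incident G e x ≡ true) (cong proj₁ p) (incident-end₁ e)
  Joins⇒incident {e} (inj₂ p) = subst (λ x → incident G e x ≡ true) (cong proj₂ p) (incident-end₂ e)

  Reach-trans : ∀ {S u v w} → Reach G S u v → Reach G S v w → Reach G S u w
  Reach-trans here                 q = q
  Reach-trans (step e e∈S e⇒ rest) q = step e e∈S e⇒ (Reach-trans rest q)

  edge⇒Reach : ∀ {S u w} e → lookup S e ≡ true → Joins G e u w → Reach G S u w
  edge⇒Reach e e∈S e⇒ = step e e∈S e⇒ here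

  Reach-sym : ∀ {S u v} → Reach G S u v → Reach G S v u
  Reach-sym here                 = here
  Reach-sym (step e e∈S e⇒ rest) = Reach-trans (Reach-sym rest) (edge⇒Reach e e∈S (Joins-sym e⇒))

  Reach-end₁ : ∀ {S e v} → lookup S e ≡ true → incident G e v ≡ true → Reach G S v (end₁ e)
  Reach-end₁ {e = e} e∈S e∋v with incident⇒end e∋v
  ... | inj₁ refl = here
  ... | inj₂ refl = edge⇒Reach e e∈S (inj₂ refl)

  head : Dart G → Fin n
  head d = tail G (α G d)

  α-involutive : ∀ d → α G (α G d) ≡ d
  α-involutive (e , true)  = refl
  α-involutive (e , false) = refl

  α-injective : ∀ {d d'} → α G d ≡ α G d' → d ≡ d'
  α-injective {d} {d'} eq = trans (sym (α-involutive d)) (trans (cong (α G) eq) (α-involutive d'))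

  ≢α : ∀ d → d ≢ α G d
  ≢α (e , true)  ()
  ≢α (e , false) ()

  same-edge⇒≡∨≡α : ∀ d d' → proj₁ d ≡ proj₁ d' → d ≡ d' ⊎ d ≡ α G d'
  same-edge⇒≡∨≡α (e , true)  (.e , true)  refl = inj₁ refl
  same-edge⇒≡∨≡α (e , true)  (.e , false) refl = inj₂ refl
  same-edge⇒≡∨≡α (e , false) (.e , true)  refl = inj₂ refl
  same-edge⇒≡∨≡α (e , false) (.e , false) refl = inj₁ refl

  dart-≟ : (d d' : Dart G) → Dec (d ≡ d')
  dart-≟ = Productₚ.≡-dec _≟_ Bool._≟_

  orient : Fin m → Fin n → Dart G
  orient e x = e , ⌊ end₁ e ≟ x ⌋

  tail-orient : ∀ {e x} → incident G e x ≡ true → tail G (orient e x) ≡ x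
  tail-orient {e} {x} e∋x with end₁ e ≟ x | incident⇒end e∋x
  ... | yes p | _       = p
  ... | no ≢x | inj₁ p  = ⊥-elim (≢x p)
  ... | no _  | inj₂ q  = q

  ≡orient : ∀ d {x} → tail G d ≡ x → d ≡ orient (proj₁ d) x
  ≡orient (e , true)  {x} p with end₁ e ≟ x
  ... | yes _ = refl
  ... | no ≢x = ⊥-elim (≢x p)
  ≡orient (e , false) {x} p with end₁ e ≟ x
  ... | yes q = ⊥-elim (loopless e (trans q (sym p)))
  ... | no _  = refl

  incident-tail : ∀ d → incident G (proj₁ d) (tail G d) ≡ true
  incident-tail (e , true)  = incident-end₁ e
  incident-tail (e , false) = incident-end₂ e

  incident-head : ∀ d → incident G (proj₁ d) (head d) ≡ true
  incident-head (e , b) = incident-tail (e , not b)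

  head≢tail : ∀ d → head d ≢ tail G d
  head≢tail (e , true)  p = loopless e (sym p)
  head≢tail (e , false) p = loopless e p

  Joins-dart : ∀ d → Joins G (proj₁ d) (tail G d) (head d)
  Joins-dart (e , true)  = inj₁ refl
  Joins-dart (e , false) = inj₂ refl

  Joins⇒head : ∀ d {u w} → Joins G (proj₁ d) u w → tail G d ≡ u → head d ≡ w
  Joins⇒head (e , true)  (inj₁ p) _ = cong proj₂ p
  Joins⇒head (e , true)  (inj₂ p) t = ⊥-elim (loopless e (trans t (sym (cong proj₂ p))))
  Joins⇒head (e , false) (inj₁ p) t = ⊥-elim (loopless e (trans (cong proj₁ p) (sym t)))
  Joins⇒head (e , false) (inj₂ p) _ = cong proj₁ p

  Joins⇒tail : ∀ d {u w} → Joins G (proj₁ d) u w → head d ≡ u → tail G d ≡ w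
  Joins⇒tail d e⇒ h = trans (cong (tail G) (sym (α-involutive d))) (Joins⇒head (α G d) e⇒ h)

  lookup-complement : ∀ C e → lookup (complement G C) e ≡ not (lookup C e)
  lookup-complement C e = lookup-map e not C

  lookup-∪ₑ : ∀ S T e → lookup (_∪ₑ_ G S T) e ≡ lookup S e ∨ lookup T e
  lookup-∪ₑ S T e = lookup-zipWith _∨_ e S T

  lookup-+₂ : ∀ S T e → lookup (_+₂_ G S T) e ≡ lookup S e xor lookup T e
  lookup-+₂ S T e = lookup-zipWith _xor_ e S T

  lookup-allEdges : ∀ e → lookup (allEdges G) e ≡ true
  lookup-allEdges e = lookup-replicate e true

  lookup-zero₂ : ∀ e → lookup (zero₂ G) e ≡ false
  lookup-zero₂ e = lookup-replicate e false

  ⊆ₑ-false : ∀ {S T e} → _⊆ₑ_ G S T → lookup T e ≡ false → lookup S e ≡ false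
  ⊆ₑ-false {S} {e = e} S⊆T e∉T with lookup S e in e∈S
  ... | false = refl
  ... | true  = trans (sym (S⊆T e e∈S)) e∉T

  degIn-linear : ∀ S₁ S₂ S₃ S₄ v →
    (∀ e → bit (lookup S₁ e) + bit (lookup S₂ e) ≡ bit (lookup S₃ e) + bit (lookup S₄ e)) →
    degIn G S₁ v + degIn G S₂ v ≡ degIn G S₃ v + degIn G S₄ v
  degIn-linear S₁ S₂ S₃ S₄ v eq = sum-map-linear _ _ _ _ (λ e → restrict (lookup S₁ e) (lookup S₂ e) (lookup S₃ e) (lookup S₄ e) (eq e) (incident G e v)) (allFin m)
    where
    restrict : ∀ a b c d → bit a + bit b ≡ bit c + bit d → ∀ i → bit (a ∧ i) + bit (b ∧ i) ≡ bit (c ∧ i) + bit (d ∧ i)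
    restrict a b c d eq true rewrite ∧-identityʳ a | ∧-identityʳ b | ∧-identityʳ c | ∧-identityʳ d = eq
    restrict a b c d eq false rewrite ∧-zeroʳ a | ∧-zeroʳ b | ∧-zeroʳ c | ∧-zeroʳ d = refl

  degIn-zero₂ : ∀ v → degIn G (zero₂ G) v ≡ 0
  degIn-zero₂ v = trans (cong sum (map-cong (λ e → cong (λ b → bit (b ∧ incident G e v)) (lookup-zero₂ e)) (allFin m)))
                        (zeros (allFin m))
    where
    zeros : (es : List (Fin m)) → sum (List.map (λ _ → 0) es) ≡ 0
    zeros []       = refl
    zeros (_ ∷ es) = zeros es

  degIn≡suc⇒∃ : ∀ S v {k} → degIn G S v ≡ suc k → ∃[ e ] lookup S e ≡ true
  degIn≡suc⇒∃ S v eq with sum-map-bit≡suc⇒∃ (λ e → lookup S e ∧ incident G e v) (allFin m) eq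
  ... | e , e∈S = e , ∧-true⇒ˡ (lookup S e) e∈S

  +₂-comm : ∀ S T → _+₂_ G S T ≡ _+₂_ G T S
  +₂-comm S T = lookup-extensionality λ e →
    trans (lookup-+₂ S T e) (trans (xor-comm (lookup S e) (lookup T e)) (sym (lookup-+₂ T S e)))

  Adj𝔡-sym : ∀ {h₁ h₂} → Adj𝔡 G h₁ h₂ → Adj𝔡 G h₂ h₁
  Adj𝔡-sym (inj₁ h₁→h₂) = inj₂ h₁→h₂
  Adj𝔡-sym (inj₂ h₂→h₁) = inj₁ h₂→h₁

  ChromaticClique-swap : ∀ {h₁ h₂ h₃} → ChromaticClique G h₁ h₂ h₃ → ChromaticClique G h₂ h₁ h₃
  ChromaticClique-swap {h₁} {h₂} {h₃} (wh₁ , wh₂ , wh₃ , h₁≢h₂ , h₁≢h₃ , h₂≢h₃ , h₁~h₂ , h₁~h₃ , h₂~h₃ , sum≡0) =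
    wh₂ , wh₁ , wh₃ , (λ eq → h₁≢h₂ (sym eq)) , h₂≢h₃ , h₁≢h₃ , Adj𝔡-sym h₁~h₂ , h₂~h₃ , h₁~h₃ ,
    trans (cong (λ X → _+₂_ G X h₃) (+₂-comm h₂ h₁)) sum≡0

  module _ (cubic : Cubic G) where

    record Star (v : Fin n) : Set where
      field
        a₁ a₂ a₃       : Fin m
        a₁≢a₂          : a₁ ≢ a₂
        a₁≢a₃          : a₁ ≢ a₃
        a₂≢a₃          : a₂ ≢ a₃
        a₁∋v           : incident G a₁ v ≡ true
        a₂∋v           : incident G a₂ v ≡ true
        a₃∋v           : incident G a₃ v ≡ true
        only           : ∀ e → incident G e v ≡ true → e ≡ a₁ ⊎ e ≡ a₂ ⊎ e ≡ a₃
        degIn-star     : ∀ S → degIn G S v ≡ bit (lookup S a₁) + (bit (lookup S a₂) + (bit (lookup S a₃) + 0))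

    abstract
      star : ∀ v → Star v
      star v = fromList edgesAt refl length≡3
        where
        edgesAt : List (Fin m)
        edgesAt = filter (λ e → incident G e v Bool.≟ true) (allFin m)

        length≡3 : length edgesAt ≡ 3
        length≡3 = begin
          length edgesAt                                    ≡⟨ sum-map-ones edgesAt ⟨
          sum (List.map (λ _ → 1) edgesAt)                  ≡⟨ cong sum (map-cong (λ e → cong bit (lookup-allEdges e)) edgesAt) ⟨
          sum (List.map (λ e → bit (lookup (allEdges G) e)) edgesAt) ≡⟨ sum-map-bit-∧ _ _ (allFin m) ⟨
          degIn G (allEdges G) v                            ≡⟨ cubic v ⟩
          3                                                 ∎
          where open ≡-Reasoning

        fromList : ∀ es → edgesAt ≡ es → length es ≡ 3 → Star v
        fromList (a ∷ b ∷ c ∷ []) listing _ = record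
          { a₁ = a ; a₂ = b ; a₃ = c
          ; a₁≢a₂ = All.head (AllPairs.head uniq)
          ; a₁≢a₃ = All.head (All.tail (AllPairs.head uniq))
          ; a₂≢a₃ = All.head (AllPairs.head (AllPairs.tail uniq))
          ; a₁∋v = incident⁻ (here refl)
          ; a₂∋v = incident⁻ (there (here refl))
          ; a₃∋v = incident⁻ (there (there (here refl)))
          ; only = λ e e∋v → listed (subst (e ∈_) listing (∈-filter⁺ _ (∈-allFin e) e∋v))
          ; degIn-star = λ S → trans (sum-map-bit-∧ (lookup S) (λ e → incident G e v) (allFin m))
                                     (cong (λ es → sum (List.map (λ e → bit (lookup S e)) es)) listing)
          }
          where
          uniq : Unique (a ∷ b ∷ c ∷ [])
          uniq = subst Unique listing (Uniqueₚ.filter⁺ _ (Uniqueₚ.allFin⁺ m))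
          incident⁻ : ∀ {e} → e ∈ a ∷ b ∷ c ∷ [] → incident G e v ≡ true
          incident⁻ {e} e∈ = proj₂ (∈-filter⁻ (λ e → incident G e v Bool.≟ true) {xs = allFin m} (subst (e ∈_) (sym listing) e∈))
          listed : ∀ {e} → e ∈ a ∷ b ∷ c ∷ [] → e ≡ a ⊎ e ≡ b ⊎ e ≡ c
          listed (here p)                 = inj₁ p
          listed (there (here p))         = inj₂ (inj₁ p)
          listed (there (there (here p))) = inj₂ (inj₂ p)

    rotate : ∀ {v} → Star v → Star v
    rotate st = record
      { a₁ = a₂ ; a₂ = a₃ ; a₃ = a₁
      ; a₁≢a₂ = a₂≢a₃ ; a₁≢a₃ = λ p → a₁≢a₂ (sym p) ; a₂≢a₃ = λ p → a₁≢a₃ (sym p)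
      ; a₁∋v = a₂∋v ; a₂∋v = a₃∋v ; a₃∋v = a₁∋v
      ; only = λ e e∋v → rotate-cases (only e e∋v)
      ; degIn-star = λ S → trans (degIn-star S) (rotate-sum (bit (lookup S a₁)) (bit (lookup S a₂)) (bit (lookup S a₃)))
      }
      where
      open Star st
      rotate-cases : ∀ {e} → e ≡ a₁ ⊎ e ≡ a₂ ⊎ e ≡ a₃ → e ≡ a₂ ⊎ e ≡ a₃ ⊎ e ≡ a₁
      rotate-cases (inj₁ p)        = inj₂ (inj₂ p)
      rotate-cases (inj₂ (inj₁ p)) = inj₁ p
      rotate-cases (inj₂ (inj₂ p)) = inj₂ (inj₁ p)
      rotate-sum : ∀ x y z → x + (y + (z + 0)) ≡ y + (z + (x + 0))
      rotate-sum x y z = trans (+-comm x _) (trans (+-assoc y (z + 0) x)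
        (cong (y +_) (trans (+-assoc z 0 x) (cong (z +_) (sym (+-identityʳ x))))))

    module TwoFactorStructure (D : EdgeSet G) (two : TwoFactor G D) where

      record DEdgesAt (v : Fin n) : Set where
        field
          e₁ e₂    : Fin m
          e₁≢e₂    : e₁ ≢ e₂
          e₁∈D     : lookup D e₁ ≡ true
          e₂∈D     : lookup D e₂ ≡ true
          e₁∋v     : incident G e₁ v ≡ true
          e₂∋v     : incident G e₂ v ≡ true
          only     : ∀ e → lookup D e ≡ true → incident G e v ≡ true → e ≡ e₁ ⊎ e ≡ e₂
          degIn-⊆  : ∀ S → _⊆ₑ_ G S D → degIn G S v ≡ bit (lookup S e₁) + bit (lookup S e₂)

      private
        fromStar : ∀ {v} (st : Star v) → lookup D (Star.a₁ st) ≡ true → lookup D (Star.a₂ st) ≡ true →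
                   lookup D (Star.a₃ st) ≡ false → DEdgesAt v
        fromStar {v} st a₁∈D a₂∈D a₃∉D = record
          { e₁ = a₁ ; e₂ = a₂ ; e₁≢e₂ = a₁≢a₂ ; e₁∈D = a₁∈D ; e₂∈D = a₂∈D ; e₁∋v = a₁∋v ; e₂∋v = a₂∋v
          ; only = onlyD ; degIn-⊆ = degIn-⊆ }
          where
          open Star st
          onlyD : ∀ e → lookup D e ≡ true → incident G e v ≡ true → e ≡ a₁ ⊎ e ≡ a₂
          onlyD e e∈D e∋v with only e e∋v
          ... | inj₁ p        = inj₁ p
          ... | inj₂ (inj₁ p) = inj₂ p
          ... | inj₂ (inj₂ refl) with trans (sym e∈D) a₃∉D
          ... | ()
          degIn-⊆ : ∀ S → _⊆ₑ_ G S D → degIn G S v ≡ bit (lookup S a₁) + bit (lookup S a₂)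
          degIn-⊆ S S⊆D = trans (degIn-star S)
            (trans (cong (λ b → bit (lookup S a₁) + (bit (lookup S a₂) + (bit b + 0))) (⊆ₑ-false {S} {D} S⊆D a₃∉D))
                   (cong (bit (lookup S a₁) +_) (+-identityʳ _)))

      abstract
        dEdgesAt : ∀ v → DEdgesAt v
        dEdgesAt v with bit³≡2 _ _ _ (trans (sym (Star.degIn-star (star v) D)) (two v))
        ... | inj₁ (a₁∈D , a₂∈D , a₃∉D)        = fromStar (star v) a₁∈D a₂∈D a₃∉D
        ... | inj₂ (inj₁ (a₁∈D , a₂∉D , a₃∈D)) = fromStar (rotate (rotate (star v))) a₃∈D a₁∈D a₂∉D
        ... | inj₂ (inj₂ (a₁∉D , a₂∈D , a₃∈D)) = fromStar (rotate (star v)) a₂∈D a₃∈D a₁∉D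

      degIn-⊆-pair : ∀ {v f f'} → f ≢ f' → lookup D f ≡ true → lookup D f' ≡ true →
        incident G f v ≡ true → incident G f' v ≡ true →
        ∀ S → _⊆ₑ_ G S D → degIn G S v ≡ bit (lookup S f) + bit (lookup S f')
      degIn-⊆-pair {v} {f} {f'} f≢f' f∈D f'∈D f∋v f'∋v S S⊆D
        with DEdgesAt.only (dEdgesAt v) f f∈D f∋v | DEdgesAt.only (dEdgesAt v) f' f'∈D f'∋v
      ... | inj₁ refl | inj₁ refl = ⊥-elim (f≢f' refl)
      ... | inj₂ refl | inj₂ refl = ⊥-elim (f≢f' refl)
      ... | inj₁ refl | inj₂ refl = DEdgesAt.degIn-⊆ (dEdgesAt v) S S⊆D
      ... | inj₂ refl | inj₁ refl = trans (DEdgesAt.degIn-⊆ (dEdgesAt v) S S⊆D) (+-comm (bit (lookup S _)) _)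

      module _ (v : Fin n) where
        open DEdgesAt (dEdgesAt v)

        other : Fin m → Fin m
        other e with e₁ ≟ e
        ... | yes _ = e₂
        ... | no _  = e₁

        private
          other-e₁ : other e₁ ≡ e₂
          other-e₁ with e₁ ≟ e₁
          ... | yes _ = refl
          ... | no ≢e = ⊥-elim (≢e refl)

          other-e₂ : other e₂ ≡ e₁
          other-e₂ with e₁ ≟ e₂
          ... | yes eq = ⊥-elim (e₁≢e₂ eq)
          ... | no _   = refl

          cases : ∀ {e} → lookup D e ≡ true → incident G e v ≡ true →
                  (e ≡ e₁ × other e ≡ e₂) ⊎ (e ≡ e₂ × other e ≡ e₁)
          cases {e} e∈D e∋v with only e e∈D e∋v
          ... | inj₁ refl = inj₁ (refl , other-e₁)
          ... | inj₂ refl = inj₂ (refl , other-e₂)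

        module _ {e : Fin m} (e∈D : lookup D e ≡ true) (e∋v : incident G e v ≡ true) where

          other-∈D : lookup D (other e) ≡ true
          other-∈D with cases e∈D e∋v
          ... | inj₁ (_ , q) = trans (cong (lookup D) q) e₂∈D
          ... | inj₂ (_ , q) = trans (cong (lookup D) q) e₁∈D

          other-incident : incident G (other e) v ≡ true
          other-incident with cases e∈D e∋v
          ... | inj₁ (_ , q) = trans (cong (λ f → incident G f v) q) e₂∋v
          ... | inj₂ (_ , q) = trans (cong (λ f → incident G f v) q) e₁∋v

          other≢ : other e ≢ e
          other≢ with cases e∈D e∋v
          ... | inj₁ (p , q) = λ r → e₁≢e₂ (trans (sym p) (trans (sym r) q))
          ... | inj₂ (p , q) = λ r → e₁≢e₂ (trans (sym q) (trans r p))

          other-involutive : other (other e) ≡ e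
          other-involutive with cases e∈D e∋v
          ... | inj₁ (p , q) = trans (cong other q) (trans other-e₂ (sym p))
          ... | inj₂ (p , q) = trans (cong other q) (trans other-e₁ (sym p))

          ≡∨≡other : ∀ f → lookup D f ≡ true → incident G f v ≡ true → f ≡ e ⊎ f ≡ other e
          ≡∨≡other f f∈D f∋v with cases e∈D e∋v | only f f∈D f∋v
          ... | inj₁ (p , _) | inj₁ r = inj₁ (trans r (sym p))
          ... | inj₁ (_ , q) | inj₂ r = inj₂ (trans r (sym q))
          ... | inj₂ (_ , q) | inj₁ r = inj₂ (trans r (sym q))
          ... | inj₂ (p , _) | inj₂ r = inj₁ (trans r (sym p))

      InD : Dart G → Set
      InD d = lookup D (proj₁ d) ≡ true

      next : Dart G → Dart G
      next d = orient (other (head d) (proj₁ d)) (head d)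

      next-InD : ∀ d → InD d → InD (next d)
      next-InD d d∈D = other-∈D (head d) d∈D (incident-head d)

      tail-next : ∀ d → InD d → tail G (next d) ≡ head d
      tail-next d d∈D = tail-orient (other-incident (head d) d∈D (incident-head d))

      next-α-next : ∀ d → InD d → next (α G (next d)) ≡ α G d
      next-α-next (e , b) d∈D = begin
        orient (other (head (α G (next (e , b)))) e') (head (α G (next (e , b))))
          ≡⟨ cong (λ y → orient (other y e') y) back ⟩
        orient (other x e') x  ≡⟨ cong (λ f → orient f x) (other-involutive x d∈D (incident-head (e , b))) ⟩
        orient e x             ≡⟨ ≡orient (e , not b) refl ⟨
        (e , not b)            ∎
        where
        open ≡-Reasoning
        x : Fin n
        x = head (e , b)
        e' : Fin m
        e' = other x e
        back : head (α G (next (e , b))) ≡ x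
        back = trans (cong (tail G) (α-involutive (next (e , b)))) (tail-next (e , b) d∈D)

      next-injective : ∀ d d' → InD d → InD d' → next d ≡ next d' → d ≡ d'
      next-injective d d' d∈D d'∈D eq =
        α-injective (trans (sym (next-α-next d d∈D)) (trans (cong (λ d → next (α G d)) eq) (next-α-next d' d'∈D)))

      next≢α : ∀ d → InD d → d ≢ α G (next d)
      next≢α d d∈D eq = other≢ (head d) d∈D (incident-head d) (sym (cong proj₁ eq))

      module Walk (s₀ : Dart G) (s₀∈D : InD s₀) where

        walk : ℕ → Dart G
        walk k = iter next k s₀

        walk-InD : ∀ k → InD (walk k)
        walk-InD zero    = s₀∈D
        walk-InD (suc k) = next-InD (walk k) (walk-InD k)

        private
          never-reverses : ∀ b a → walk a ≢ α G (walk (b + a))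
          never-reverses zero          a    = ≢α (walk a)
          never-reverses (suc zero)    a    = next≢α (walk a) (walk-InD a)
          never-reverses (suc (suc b)) a eq = never-reverses b (suc a)
            (subst (λ k → walk (suc a) ≡ α G (walk k)) (sym (+-suc b a))
                   (trans (cong next eq) (next-α-next (walk (suc (b + a))) (walk-InD (suc (b + a))))))

        walk≢α-walk : ∀ i j → walk i ≢ α G (walk j)
        walk≢α-walk i j with ≤-total i j
        ... | inj₁ i≤j = subst (λ k → walk i ≢ α G (walk k)) (m∸n+n≡m i≤j) (never-reverses (j ∸ i) i)
        ... | inj₂ j≤i = λ eq → subst (λ k → walk j ≢ α G (walk k)) (m∸n+n≡m j≤i) (never-reverses (i ∸ j) j)
                                  (sym (trans (cong (α G) eq) (α-involutive (walk j))))

        walk-edge-injective : ∀ i j → proj₁ (walk i) ≡ proj₁ (walk j) → walk i ≡ walk j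
        walk-edge-injective i j eq with same-edge⇒≡∨≡α (walk i) (walk j) eq
        ... | inj₁ p = p
        ... | inj₂ p = ⊥-elim (walk≢α-walk i j p)

        walk-cancel : ∀ k i j → walk (k + i) ≡ walk (k + j) → walk i ≡ walk j
        walk-cancel zero    i j eq = eq
        walk-cancel (suc k) i j eq = walk-cancel k i j (next-injective (walk (k + i)) (walk (k + j)) (walk-InD (k + i)) (walk-InD (k + j)) eq)

        repeat⇒returns : ∀ i d → walk i ≡ walk (i + d) → walk 0 ≡ walk d
        repeat⇒returns i d eq = walk-cancel i 0 d (subst (λ k → walk k ≡ walk (i + d)) (sym (+-identityʳ i)) eq)

        Returns : ℕ → Set
        Returns k = 0 < k × walk k ≡ walk 0

        -- The m + 1 darts walk 0, …, walk m use some edge twice.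
        returns : ∃[ k ] Returns k
        returns with Finₚ.pigeonhole (n<1+n m) (λ i → proj₁ (walk (toℕ i)))
        ... | i , j , i<j , eq with <⇒≡+suc i<j
        ... | d , j≡ = suc d , s≤s z≤n ,
          sym (repeat⇒returns (toℕ i) (suc d) (subst (λ k → walk (toℕ i) ≡ walk k) j≡ (walk-edge-injective (toℕ i) (toℕ j) eq)))

        abstract
          least-return : ∃[ k ] (Returns k × (∀ {j} → j < k → ¬ Returns j))
          least-return = least (λ k → (0 <? k) ×-dec dart-≟ (walk k) (walk 0)) (proj₂ returns)

        period : ℕ
        period = proj₁ least-return

        period>0 : 0 < period
        period>0 = proj₁ (proj₁ (proj₂ least-return))

        walk-period : walk period ≡ walk 0
        walk-period = proj₂ (proj₁ (proj₂ least-return))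

        period-least : ∀ {j} → j < period → ¬ Returns j
        period-least = proj₂ (proj₂ least-return)

        instance
          period-nonZero : NonZero period
          period-nonZero = >-nonZero period>0

        walk-+-period : ∀ k → walk (k + period) ≡ walk k
        walk-+-period k = trans (iter-+ next k period s₀) (cong (iter next k) walk-period)

        walk-+-*period : ∀ q r → walk (r + q * period) ≡ walk r
        walk-+-*period zero    r = cong walk (+-identityʳ r)
        walk-+-*period (suc q) r = begin
          walk (r + (period + q * period)) ≡⟨ cong walk (trans (cong (r +_) (+-comm period _)) (sym (+-assoc r _ period))) ⟩
          walk (r + q * period + period)   ≡⟨ walk-+-period (r + q * period) ⟩
          walk (r + q * period)            ≡⟨ walk-+-*period q r ⟩
          walk r                           ∎
          where open ≡-Reasoning

        walk-mod : ∀ i → walk i ≡ walk (i % period)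
        walk-mod i = trans (cong walk (m≡m%n+[m/n]*n i period)) (walk-+-*period (i / period) (i % period))

        walk-distinct : ∀ {i j} → i < j → j < period → walk i ≢ walk j
        walk-distinct {i} i<j j<p eq with <⇒≡+suc i<j
        ... | d , refl = period-least (≤-<-trans (m≤n+m (suc d) i) j<p) (s≤s z≤n , sym (repeat⇒returns i (suc d) eq))

        returns⇒period∣ : ∀ d → walk 0 ≡ walk d → d % period ≡ 0
        returns⇒period∣ d eq with d % period in r≡
        ... | zero  = refl
        ... | suc r = ⊥-elim (period-least (subst (_< period) r≡ (m%n<n d period))
                        (s≤s z≤n , sym (trans eq (trans (walk-mod d) (cong walk r≡)))))

        private
          same-parity-≤ : odd period ≡ false → ∀ {i j} → i ≤ j → walk i ≡ walk j → odd i ≡ odd j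
          same-parity-≤ even {i} {j} i≤j eq = sym (begin
            odd j               ≡⟨ cong odd j≡i+d ⟩
            odd (i + d)         ≡⟨ odd-+ i d ⟩
            odd i xor odd d     ≡⟨ cong (odd i xor_) d-even ⟩
            odd i xor false     ≡⟨ xor-identityʳ (odd i) ⟩
            odd i               ∎)
            where
            open ≡-Reasoning
            d : ℕ
            d = j ∸ i
            j≡i+d : j ≡ i + d
            j≡i+d = sym (trans (+-comm i d) (m∸n+n≡m i≤j))
            d≡ : d ≡ (d / period) * period
            d≡ = trans (m≡m%n+[m/n]*n d period) (cong (_+ (d / period) * period)
                   (returns⇒period∣ d (repeat⇒returns i d (subst (λ k → walk i ≡ walk k) j≡i+d eq))))
            d-even : odd d ≡ false
            d-even = trans (cong odd d≡) (odd-*-even (d / period) even)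

        repeat⇒same-parity : odd period ≡ false → ∀ i j → walk i ≡ walk j → odd i ≡ odd j
        repeat⇒same-parity even i j eq with ≤-total i j
        ... | inj₁ i≤j = same-parity-≤ even i≤j eq
        ... | inj₂ j≤i = sym (same-parity-≤ even j≤i (sym eq))

        vertex : ℕ → Fin n
        vertex k = head (walk k)

        edge : ℕ → Fin m
        edge k = proj₁ (walk k)

        tail-walk-suc : ∀ k → tail G (walk (suc k)) ≡ vertex k
        tail-walk-suc k = tail-next (walk k) (walk-InD k)

        Reach-vertex : ∀ k → Reach G D (vertex 0) (vertex k)
        Reach-vertex zero    = here
        Reach-vertex (suc k) = Reach-trans (Reach-vertex k) (edge⇒Reach (edge (suc k)) (walk-InD (suc k))
          (subst (λ x → Joins G (edge (suc k)) x (vertex (suc k))) (tail-walk-suc k) (Joins-dart (walk (suc k)))))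

        private
          tail-walk : ∀ i → tail G (walk i) ≡ vertex (i + pred period)
          tail-walk i = trans (cong (tail G) (sym (walk-+-period i)))
            (trans (cong (λ k → tail G (walk k)) (trans (cong (i +_) (sym (suc-pred period))) (+-suc i _)))
                   (tail-walk-suc (i + pred period)))

        Reach⇒on-walk : ∀ {u w} → Reach G D u w → ∀ i → vertex i ≡ u → ∃[ j ] vertex j ≡ w
        Reach⇒on-walk here i eq = i , eq
        Reach⇒on-walk (step e e∈D e⇒ rest) i eq
          with ≡∨≡other (vertex i) (walk-InD i) (incident-head (walk i)) e e∈D
                 (subst (λ x → incident G e x ≡ true) (sym eq) (Joins⇒incident e⇒))
        ... | inj₁ refl = Reach⇒on-walk rest (i + pred period) (trans (sym (tail-walk i)) (Joins⇒tail (walk i) e⇒ eq))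
        ... | inj₂ refl = Reach⇒on-walk rest (suc i) (Joins⇒head (walk (suc i)) e⇒ (trans (tail-walk-suc i) eq))

        vertex-distinct : ∀ {i j} → i < j → j < period → vertex i ≢ vertex j
        vertex-distinct {i} {j} i<j j<p eq
          with ≡∨≡other (vertex i) (walk-InD i) (incident-head (walk i)) (edge j) (walk-InD j)
                 (subst (λ x → incident G (edge j) x ≡ true) (sym eq) (incident-head (walk j)))
        ... | inj₁ q = walk-distinct i<j j<p (sym (walk-edge-injective j i q))
        ... | inj₂ q with same-edge⇒≡∨≡α (walk j) (walk (suc i)) q
        ...   | inj₁ r = head≢tail (walk j) (trans (sym eq) (trans (sym (tail-walk-suc i)) (cong (tail G) (sym r))))
        ...   | inj₂ r = walk≢α-walk j (suc i) r

        cycle : List (Fin n)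
        cycle = applyUpTo vertex period

        cycle-unique : Unique cycle
        cycle-unique = Uniqueₚ.applyUpTo⁺₁ vertex period vertex-distinct

        Reach⇒on-cycle : ∀ {w} → Reach G D (vertex 0) w → ∃[ i ] (i < period × vertex i ≡ w)
        Reach⇒on-cycle r with Reach⇒on-walk r 0 refl
        ... | j , refl = j % period , m%n<n j period , cong head (sym (walk-mod j))

        ∈-cycle⁺ : ∀ {w} → Reach G D (vertex 0) w → w ∈ cycle
        ∈-cycle⁺ r with Reach⇒on-cycle r
        ... | i , i<p , refl = ∈-applyUpTo⁺ vertex i<p

        ∈-cycle⁻ : ∀ {w} → w ∈ cycle → Reach G D (vertex 0) w
        ∈-cycle⁻ w∈ with ∈-applyUpTo⁻ vertex w∈
        ... | i , _ , refl = Reach-vertex i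

        edge-suc-incident : ∀ k → incident G (edge (suc k)) (vertex k) ≡ true
        edge-suc-incident k = other-incident (vertex k) (walk-InD k) (incident-head (walk k))

        degIn-vertex : ∀ k S → _⊆ₑ_ G S D → degIn G S (vertex k) ≡ bit (lookup S (edge k)) + bit (lookup S (edge (suc k)))
        degIn-vertex k = degIn-⊆-pair (λ eq → other≢ (vertex k) (walk-InD k) (incident-head (walk k)) (sym eq))
          (walk-InD k) (walk-InD (suc k)) (incident-head (walk k)) (edge-suc-incident k)

        -- A perfect matching inside D contains every other edge of the walk.
        perfect-matching⇒period-even : ∀ M → _⊆ₑ_ G M D → (∀ v → degIn G M v ≡ 1) → odd period ≡ false
        perfect-matching⇒period-even M M⊆D M-perfect =
          xor-cancelˡ (lookup M (edge 0)) (trans (sym (by-parity period))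
            (trans (cong (λ d → lookup M (proj₁ d)) walk-period) (sym (xor-identityʳ _))))
          where
          by-parity : ∀ k → lookup M (edge k) ≡ lookup M (edge 0) xor odd k
          by-parity zero    = sym (xor-identityʳ _)
          by-parity (suc k) = begin
            lookup M (edge (suc k))              ≡⟨ bit+bit≡1⇒≡not _ _ (trans (sym (degIn-vertex k M M⊆D)) (M-perfect (vertex k))) ⟩
            not (lookup M (edge k))              ≡⟨ cong not (by-parity k) ⟩
            not (lookup M (edge 0) xor odd k)    ≡⟨ not-distribʳ-xor (lookup M (edge 0)) (odd k) ⟩
            lookup M (edge 0) xor odd (suc k)    ∎
            where open ≡-Reasoning

      module Cycle (v : Fin n) where
        open Walk (α G (orient (DEdgesAt.e₁ (dEdgesAt v)) v)) (DEdgesAt.e₁∈D (dEdgesAt v)) public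

        vertex-0 : vertex 0 ≡ v
        vertex-0 = trans (cong (tail G) (α-involutive (orient (DEdgesAt.e₁ (dEdgesAt v)) v))) (tail-orient (DEdgesAt.e₁∋v (dEdgesAt v)))

        ∈-cycle⇔Reach : ∀ w → w ∈ cycle ⇔ Reach G D v w
        ∈-cycle⇔Reach w = mk⇔ (λ w∈ → subst (λ x → Reach G D x w) vertex-0 (∈-cycle⁻ w∈))
                              (λ r → ∈-cycle⁺ (subst (λ x → Reach G D x w) (sym vertex-0) r))

        cycle-HasSize : HasSize (Reach G D v) period
        cycle-HasSize = cycle , cycle-unique , ∈-cycle⇔Reach , length-applyUpTo vertex period

        HasSize⇒≡period : ∀ {k} → HasSize (Reach G D v) k → k ≡ period
        HasSize⇒≡period (ws , ws-unique , ∈ws⇔ , refl) = trans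
          (Unique⇒length≡ ws-unique cycle-unique (λ w → mk⇔
            (λ w∈ → Equivalence.from (∈-cycle⇔Reach w) (Equivalence.to (∈ws⇔ w) w∈))
            (λ w∈ → Equivalence.from (∈ws⇔ w) (Equivalence.to (∈-cycle⇔Reach w) w∈))))
          (length-applyUpTo vertex period)

      perfect-matching⇒EvenCycles : ∀ M → _⊆ₑ_ G M D → (∀ v → degIn G M v ≡ 1) → EvenCycles G D
      perfect-matching⇒EvenCycles M M⊆D M-perfect v =
        period , cycle-HasSize , ¬odd⇒Even period (perfect-matching⇒period-even M M⊆D M-perfect)
        where open Cycle v

    _∖_ : EdgeSet G → EdgeSet G → EdgeSet G
    C ∖ F = Vec.zipWith (λ a b → a ∧ not b) C F

    lookup-∖ : ∀ C F e → lookup (C ∖ F) e ≡ lookup C e ∧ not (lookup F e)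
    lookup-∖ C F e = lookup-zipWith _ e C F

    ∖-⊆ : ∀ C F → _⊆ₑ_ G (C ∖ F) C
    ∖-⊆ C F e e∈ = ∧-true⇒ˡ (lookup C e) (trans (sym (lookup-∖ C F e)) e∈)

    mutate : EdgeSet G → EdgeSet G → EdgeSet G
    mutate C F = _∪ₑ_ G (complement G C) F

    lookup-mutate : ∀ C F e → lookup (mutate C F) e ≡ not (lookup C e) ∨ lookup F e
    lookup-mutate C F e = trans (lookup-∪ₑ (complement G C) F e) (cong (_∨ lookup F e) (lookup-complement C e))

    complement-⊆-mutate : ∀ C F → _⊆ₑ_ G (complement G C) (mutate C F)
    complement-⊆-mutate C F e e∈ = trans (lookup-∪ₑ (complement G C) F e) (cong (_∨ lookup F e) e∈)

    ⊆-mutate : ∀ C F → _⊆ₑ_ G F (mutate C F)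
    ⊆-mutate C F e e∈ = trans (lookup-∪ₑ (complement G C) F e) (trans (cong (lookup (complement G C) e ∨_) e∈) (∨-zeroʳ _))

    degIn-pointwise : ∀ S T U W v {a b c d} →
      (∀ e → bit (lookup S e) + bit (lookup T e) ≡ bit (lookup U e) + bit (lookup W e)) →
      degIn G T v ≡ b → degIn G U v ≡ c → degIn G W v ≡ d → a + b ≡ c + d → degIn G S v ≡ a
    degIn-pointwise S T U W v {a} {b} {c} {d} pointwise T≡ U≡ W≡ a+b≡ = +-cancelʳ-≡ b (degIn G S v) a (begin
      degIn G S v + b            ≡⟨ cong (degIn G S v +_) T≡ ⟨
      degIn G S v + degIn G T v  ≡⟨ degIn-linear S T U W v pointwise ⟩
      degIn G U v + degIn G W v  ≡⟨ cong₂ _+_ U≡ W≡ ⟩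
      c + d                      ≡⟨ a+b≡ ⟨
      a + b                      ∎)
      where open ≡-Reasoning

    complement-perfect : ∀ C → TwoFactor G C → ∀ v → degIn G (complement G C) v ≡ 1
    complement-perfect C C-two v = degIn-pointwise (complement G C) C (allEdges G) (zero₂ G) v
      (λ e → subst₂ (λ x y → bit x + bit (lookup C e) ≡ bit y + bit (lookup (zero₂ G) e))
                (sym (lookup-complement C e)) (sym (lookup-allEdges e))
                (subst (λ z → bit (not (lookup C e)) + bit (lookup C e) ≡ 1 + bit z) (sym (lookup-zero₂ e))
                  (pointwise (lookup C e))))
      (C-two v) (cubic v) (degIn-zero₂ v) refl
      where
      pointwise : ∀ c → bit (not c) + bit c ≡ 1 + bit false
      pointwise true  = refl
      pointwise false = refl

    module _ (C F : EdgeSet G) (F⊆C : _⊆ₑ_ G F C) where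

      mutate-∖≡mutate-mutate : mutate C (C ∖ F) ≡ mutate (mutate C F) (complement G C)
      mutate-∖≡mutate-mutate = lookup-extensionality λ e → begin
        lookup (mutate C (C ∖ F)) e                             ≡⟨ lookup-mutate C (C ∖ F) e ⟩
        not (lookup C e) ∨ lookup (C ∖ F) e                     ≡⟨ cong (not (lookup C e) ∨_) (lookup-∖ C F e) ⟩
        not (lookup C e) ∨ (lookup C e ∧ not (lookup F e))      ≡⟨ pointwise (lookup C e) (lookup F e) (F⊆C e) ⟩
        not (not (lookup C e) ∨ lookup F e) ∨ not (lookup C e)  ≡⟨ cong₂ (λ x y → not x ∨ y) (lookup-mutate C F e) (lookup-complement C e) ⟨
        not (lookup (mutate C F) e) ∨ lookup (complement G C) e ≡⟨ lookup-mutate (mutate C F) (complement G C) e ⟨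
        lookup (mutate (mutate C F) (complement G C)) e         ∎
        where
        open ≡-Reasoning
        pointwise : ∀ c f → (f ≡ true → c ≡ true) → not c ∨ (c ∧ not f) ≡ not (not c ∨ f) ∨ not c
        pointwise true  true  _ = refl
        pointwise true  false _ = refl
        pointwise false _     _ = refl

      mutations-sum-to-zero : _+₂_ G (_+₂_ G C (mutate C F)) (mutate C (C ∖ F)) ≡ zero₂ G
      mutations-sum-to-zero = lookup-extensionality λ e → begin
        lookup (_+₂_ G (_+₂_ G C (mutate C F)) (mutate C (C ∖ F))) e
          ≡⟨ lookup-+₂ (_+₂_ G C (mutate C F)) (mutate C (C ∖ F)) e ⟩
        lookup (_+₂_ G C (mutate C F)) e xor lookup (mutate C (C ∖ F)) e
          ≡⟨ cong₂ _xor_ (trans (lookup-+₂ C (mutate C F) e) (cong (lookup C e xor_) (lookup-mutate C F e)))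
                         (trans (lookup-mutate C (C ∖ F) e) (cong (not (lookup C e) ∨_) (lookup-∖ C F e))) ⟩
        (lookup C e xor (not (lookup C e) ∨ lookup F e)) xor (not (lookup C e) ∨ (lookup C e ∧ not (lookup F e)))
          ≡⟨ pointwise (lookup C e) (lookup F e) (F⊆C e) ⟩
        false
          ≡⟨ lookup-zero₂ e ⟨
        lookup (zero₂ G) e ∎
        where
        open ≡-Reasoning
        pointwise : ∀ c f → (f ≡ true → c ≡ true) → (c xor (not c ∨ f)) xor (not c ∨ (c ∧ not f)) ≡ false
        pointwise true  true  _ = refl
        pointwise true  false _ = refl
        pointwise false false _ = refl
        pointwise false true  f⇒c with f⇒c refl
        ... | ()

      mutate-mutate : C ≡ mutate (mutate C F) F
      mutate-mutate = lookup-extensionality λ e → begin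
        lookup C e                                      ≡⟨ pointwise (lookup C e) (lookup F e) (F⊆C e) ⟩
        not (not (lookup C e) ∨ lookup F e) ∨ lookup F e ≡⟨ cong (λ x → not x ∨ lookup F e) (lookup-mutate C F e) ⟨
        not (lookup (mutate C F) e) ∨ lookup F e        ≡⟨ lookup-mutate (mutate C F) F e ⟨
        lookup (mutate (mutate C F) F) e                ∎
        where
        open ≡-Reasoning
        pointwise : ∀ c f → (f ≡ true → c ≡ true) → c ≡ not (not c ∨ f) ∨ f
        pointwise true  true  _ = refl
        pointwise true  false _ = refl
        pointwise false false _ = refl
        pointwise false true  f⇒c with f⇒c refl
        ... | ()

    Mutation-sym : ∀ {C D} → Mutation G C D → Mutation G D C
    Mutation-sym {C} (F , F⊆C , F-perfect , refl) = F , ⊆-mutate C F , F-perfect , mutate-mutate C F F⊆C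

    module _ (C F : EdgeSet G) (C-two : TwoFactor G C) (F⊆C : _⊆ₑ_ G F C) (F-perfect : ∀ v → degIn G F v ≡ 1) where

      mutate-TwoFactor : TwoFactor G (mutate C F)
      mutate-TwoFactor v = degIn-pointwise (mutate C F) C (allEdges G) F v
        (λ e → subst₂ (λ x y → bit x + bit (lookup C e) ≡ bit y + bit (lookup F e))
                  (sym (lookup-mutate C F e)) (sym (lookup-allEdges e)) (pointwise (lookup C e) (lookup F e) (F⊆C e)))
        (C-two v) (cubic v) (F-perfect v) refl
        where
        pointwise : ∀ c f → (f ≡ true → c ≡ true) → bit (not c ∨ f) + bit c ≡ bit true + bit f
        pointwise true  true  _ = refl
        pointwise true  false _ = refl
        pointwise false false _ = refl
        pointwise false true  f⇒c with f⇒c refl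
        ... | ()

      -- every cycle of the mutation alternates between C^⊥ and F
      mutate-WeakHamiltonian : WeakHamiltonian G (mutate C F)
      mutate-WeakHamiltonian = mutate-TwoFactor ,
        TwoFactorStructure.perfect-matching⇒EvenCycles (mutate C F) mutate-TwoFactor
          (complement G C) (complement-⊆-mutate C F) (complement-perfect C C-two)

      ∖-perfect : ∀ v → degIn G (C ∖ F) v ≡ 1
      ∖-perfect v = degIn-pointwise (C ∖ F) F C (zero₂ G) v
        (λ e → subst₂ (λ x y → bit x + bit (lookup F e) ≡ bit (lookup C e) + bit y)
                  (sym (lookup-∖ C F e)) (sym (lookup-zero₂ e)) (pointwise (lookup C e) (lookup F e) (F⊆C e)))
        (F-perfect v) (C-two v) (degIn-zero₂ v) refl
        where
        pointwise : ∀ c f → (f ≡ true → c ≡ true) → bit (c ∧ not f) + bit f ≡ bit c + bit false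
        pointwise true  true  _ = refl
        pointwise true  false _ = refl
        pointwise false false _ = refl
        pointwise false true  f⇒c with f⇒c refl
        ... | ()

    chromatic-clique : ∀ C F → Fin n → WeakHamiltonian G C → _⊆ₑ_ G F C → (∀ v → degIn G F v ≡ 1) →
      ChromaticClique G C (mutate C F) (mutate C (C ∖ F))
    chromatic-clique C F v₀ C-wh@(C-two , _) F⊆C F-perfect =
      C-wh ,
      mutate-WeakHamiltonian C F C-two F⊆C F-perfect ,
      mutate-WeakHamiltonian C (C ∖ F) C-two (∖-⊆ C F) (∖-perfect C F C-two F⊆C F-perfect) ,
      ≢-at C∌e (complement-⊆-mutate C F e e∉C) ,
      ≢-at C∌e (complement-⊆-mutate C (C ∖ F) e e∉C) ,
      (λ eq → ≢-at mutate-∖∌f (⊆-mutate C F f f∈F) (sym eq)) ,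
      inj₁ (F , F⊆C , F-perfect , refl) ,
      inj₁ (C ∖ F , ∖-⊆ C F , ∖-perfect C F C-two F⊆C F-perfect , refl) ,
      inj₁ (complement G C , complement-⊆-mutate C F , complement-perfect C C-two , mutate-∖≡mutate-mutate C F F⊆C) ,
      mutations-sum-to-zero C F F⊆C
      where
      ≢-at : ∀ {S T e} → lookup S e ≡ false → lookup T e ≡ true → S ≢ T
      ≢-at S∌e T∋e refl with trans (sym S∌e) T∋e
      ... | ()
      e : Fin m
      e = proj₁ (degIn≡suc⇒∃ (complement G C) v₀ (complement-perfect C C-two v₀))
      e∉C : lookup (complement G C) e ≡ true
      e∉C = proj₂ (degIn≡suc⇒∃ (complement G C) v₀ (complement-perfect C C-two v₀))
      C∌e : lookup C e ≡ false
      C∌e = trans (sym (not-involutive _)) (cong not (trans (sym (lookup-complement C e)) e∉C))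
      f : Fin m
      f = proj₁ (degIn≡suc⇒∃ F v₀ (F-perfect v₀))
      f∈F : lookup F f ≡ true
      f∈F = proj₂ (degIn≡suc⇒∃ F v₀ (F-perfect v₀))
      mutate-∖∌f : lookup (mutate C (C ∖ F)) f ≡ false
      mutate-∖∌f rewrite lookup-mutate C (C ∖ F) f | lookup-∖ C F f | F⊆C f f∈F | f∈F = refl

    module AlternatingMatching (h : EdgeSet G) (h-wh : WeakHamiltonian G h) where
      open TwoFactorStructure h (proj₁ h-wh)
      open Cycle using (period; walk; edge; vertex; cycle; ∈-cycle⇔Reach)
      open import Data.List.Membership.DecPropositional (_≟_ {n = n}) using (_∈?_)

      period-even : ∀ v → odd (period v) ≡ false
      period-even v with proj₂ h-wh v
      ... | k , size , even = subst (λ x → odd x ≡ false) (Cycle.HasSize⇒≡period v size) (Even⇒¬odd k even)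

      -- Each cycle is walked from a canonical root: its first vertex in the order of Fin n.
      private
        roots : Fin n → List (Fin n)
        roots v = filter (_∈? cycle v) (allFin n)

        ∈-roots : ∀ v → v ∈ roots v
        ∈-roots v = ∈-filter⁺ (_∈? cycle v) (∈-allFin v) (Equivalence.from (∈-cycle⇔Reach v v) here)

        first : Fin n → List (Fin n) → Fin n
        first d []      = d
        first _ (x ∷ _) = x

        first-∈ : ∀ {d x xs} → x ∈ xs → first d xs ∈ xs
        first-∈ (here _)  = here refl
        first-∈ (there _) = here refl

        first-≡ : ∀ {d d' x xs ys} → x ∈ ys → xs ≡ ys → first d xs ≡ first d' ys
        first-≡ (here _)  refl = refl
        first-≡ (there _) refl = refl

      abstract
        root : Fin n → Fin n
        root v = first v (roots v)

        Reach-root : ∀ v → Reach G h v (root v)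
        Reach-root v = Equivalence.to (∈-cycle⇔Reach v (root v))
          (proj₂ (∈-filter⁻ (_∈? cycle v) {xs = allFin n} (first-∈ (∈-roots v))))

        Reach⇒root≡ : ∀ {u v} → Reach G h u v → root u ≡ root v
        Reach⇒root≡ {u} {v} u⇝v = first-≡ (∈-roots v) (filter-≐ (_∈? cycle u) (_∈? cycle v) (to , from) (allFin n))
          where
          to : ∀ {w} → w ∈ cycle u → w ∈ cycle v
          to {w} w∈ = Equivalence.from (∈-cycle⇔Reach v w) (Reach-trans (Reach-sym u⇝v) (Equivalence.to (∈-cycle⇔Reach u w) w∈))
          from : ∀ {w} → w ∈ cycle v → w ∈ cycle u
          from {w} w∈ = Equivalence.from (∈-cycle⇔Reach u w) (Reach-trans u⇝v (Equivalence.to (∈-cycle⇔Reach v w) w∈))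

      onEvenPosition : Fin n → Fin m → Bool
      onEvenPosition r e = does (anyUpTo? (λ j → (odd j Bool.≟ false) ×-dec (edge r j ≟ e)) (period r))

      onEvenPosition-edge : ∀ r j → onEvenPosition r (edge r j) ≡ not (odd j)
      onEvenPosition-edge r j with odd j in j-odd
      ... | false = dec-true (anyUpTo? _ (period r)) (j % period r , m%n<n j (period r) ,
                      trans (Cycle.repeat⇒same-parity r (period-even r) (j % period r) j same) j-odd , cong proj₁ same)
        where
        instance _ = Cycle.period-nonZero r
        same : walk r (j % period r) ≡ walk r j
        same = sym (Cycle.walk-mod r j)
      ... | true = dec-false (anyUpTo? _ (period r)) λ { (i , _ , i-even , i≡j) →
                      true≢false (trans (sym j-odd) (trans (sym (Cycle.repeat⇒same-parity r (period-even r) i j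
                        (Cycle.walk-edge-injective r i j i≡j))) i-even)) }
        where
        true≢false : true ≢ false
        true≢false ()

      alternating : EdgeSet G
      alternating = tabulate (λ e → lookup h e ∧ onEvenPosition (root (end₁ e)) e)

      alternating-⊆ : _⊆ₑ_ G alternating h
      alternating-⊆ e e∈ = ∧-true⇒ˡ (lookup h e) (trans (sym (lookup∘tabulate _ e)) e∈)

      private
        alternating-at : ∀ v j → incident G (edge (root v) j) v ≡ true → lookup alternating (edge (root v) j) ≡ not (odd j)
        alternating-at v j e∋v = begin
          lookup alternating e                             ≡⟨ lookup∘tabulate _ e ⟩
          lookup h e ∧ onEvenPosition (root (end₁ e)) e    ≡⟨ cong₂ (λ x r → x ∧ onEvenPosition r e) (Cycle.walk-InD (root v) j)
                                                                 (sym (Reach⇒root≡ (Reach-end₁ (Cycle.walk-InD (root v) j) e∋v))) ⟩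
          true ∧ onEvenPosition (root v) e                  ≡⟨ onEvenPosition-edge (root v) j ⟩
          not (odd j)                                       ∎
          where
          open ≡-Reasoning
          e : Fin m
          e = edge (root v) j

      alternating-perfect : ∀ v → degIn G alternating v ≡ 1
      alternating-perfect v with Cycle.Reach⇒on-cycle (root v)
                                   (subst (λ x → Reach G h x v) (sym (Cycle.vertex-0 (root v))) (Reach-sym (Reach-root v)))
      ... | i , _ , vᵢ≡v = begin
        degIn G alternating v
          ≡⟨ cong (degIn G alternating) vᵢ≡v ⟨
        degIn G alternating (vertex r i)
          ≡⟨ Cycle.degIn-vertex r i alternating alternating-⊆ ⟩
        bit (lookup alternating (edge r i)) + bit (lookup alternating (edge r (suc i)))
          ≡⟨ cong₂ (λ a b → bit a + bit b) (alternating-at v i (at-v (incident-head (walk r i))))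
                                           (alternating-at v (suc i) (at-v (Cycle.edge-suc-incident r i))) ⟩
        bit (not (odd i)) + bit (not (not (odd i)))
          ≡⟨ one-of (odd i) ⟩
        1 ∎
        where
        open ≡-Reasoning
        r : Fin n
        r = root v
        at-v : ∀ {e} → incident G e (vertex r i) ≡ true → incident G e v ≡ true
        at-v {e} = subst (λ x → incident G e x ≡ true) vᵢ≡v
        one-of : ∀ b → bit (not b) + bit (not (not b)) ≡ 1
        one-of true  = refl
        one-of false = refl

    -- The 1-factors of h are the alternating one, flipped on any set of cycles.
    module Neighbourhood (h : EdgeSet G) (h-wh : WeakHamiltonian G h) (reps : List (Fin n))
        (reps-apart : AllPairs (λ x y → ¬ Reach G h x y) reps)
        (reps-cover : ∀ a → ∃[ x ] (x ∈ reps × Reach G h x a)) where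
      open TwoFactorStructure h (proj₁ h-wh)
      open AlternatingMatching h h-wh using (alternating; alternating-⊆; alternating-perfect)

      N : ℕ
      N = length reps

      rep : Fin N → Fin n
      rep = List.lookup reps

      cycleOf : Fin n → Fin N
      cycleOf a = Any.index (proj₁ (proj₂ (reps-cover a)))

      Reach-cycleOf : ∀ a → Reach G h (rep (cycleOf a)) a
      Reach-cycleOf a = subst (λ x → Reach G h x a) (lookup-index (proj₁ (proj₂ (reps-cover a)))) (proj₂ (proj₂ (reps-cover a)))

      Reach-rep⇒≡ : ∀ i j → Reach G h (rep i) (rep j) → i ≡ j
      Reach-rep⇒≡ i j r with <-cmp (toℕ i) (toℕ j)
      ... | tri< i<j _ _ = ⊥-elim (AllPairs-lookup reps-apart i j i<j r)
      ... | tri≈ _ i≡j _ = Finₚ.toℕ-injective i≡j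
      ... | tri> _ _ j<i = ⊥-elim (AllPairs-lookup reps-apart j i j<i (Reach-sym r))

      Reach⇒cycleOf≡ : ∀ {u w} → Reach G h u w → cycleOf u ≡ cycleOf w
      Reach⇒cycleOf≡ {u} {w} r = Reach-rep⇒≡ (cycleOf u) (cycleOf w)
        (Reach-trans (Reach-cycleOf u) (Reach-trans r (Reach-sym (Reach-cycleOf w))))

      cycleOf-end₁ : ∀ {e v} → lookup h e ≡ true → incident G e v ≡ true → cycleOf (end₁ e) ≡ cycleOf v
      cycleOf-end₁ e∈h e∋v = sym (Reach⇒cycleOf≡ (Reach-end₁ e∈h e∋v))

      flipOn : Vec Bool N → EdgeSet G
      flipOn b = tabulate (λ e → lookup alternating e xor (lookup h e ∧ lookup b (cycleOf (end₁ e))))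

      lookup-flipOn : ∀ b e → lookup h e ≡ true → lookup (flipOn b) e ≡ lookup alternating e xor lookup b (cycleOf (end₁ e))
      lookup-flipOn b e e∈h = trans (lookup∘tabulate _ e) (cong (λ x → lookup alternating e xor (x ∧ lookup b (cycleOf (end₁ e)))) e∈h)

      flipOn-⊆ : ∀ b → _⊆ₑ_ G (flipOn b) h
      flipOn-⊆ b e e∈ = pointwise (lookup h e) (lookup alternating e) (alternating-⊆ e) (trans (sym (lookup∘tabulate _ e)) e∈)
        where
        pointwise : ∀ a f {c} → (f ≡ true → a ≡ true) → f xor (a ∧ c) ≡ true → a ≡ true
        pointwise true  _     _   _ = refl
        pointwise false true  f⇒a _ = f⇒a refl
        pointwise false false _   ()

      flipOn-perfect : ∀ b v → degIn G (flipOn b) v ≡ 1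
      flipOn-perfect b v = begin
        degIn G (flipOn b) v                                         ≡⟨ degIn-⊆ (flipOn b) (flipOn-⊆ b) ⟩
        bit (lookup (flipOn b) e₁) + bit (lookup (flipOn b) e₂)      ≡⟨ cong₂ (λ x y → bit x + bit y) flip₁ flip₂ ⟩
        bit (a xor c) + bit (not a xor c)                            ≡⟨ pointwise a c ⟩
        1                                                            ∎
        where
        open ≡-Reasoning
        open DEdgesAt (dEdgesAt v)
        a c : Bool
        a = lookup alternating e₁
        c = lookup b (cycleOf v)
        flip₁ : lookup (flipOn b) e₁ ≡ a xor c
        flip₁ = trans (lookup-flipOn b e₁ e₁∈D) (cong (λ i → a xor lookup b i) (cycleOf-end₁ e₁∈D e₁∋v))
        flip₂ : lookup (flipOn b) e₂ ≡ not a xor c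
        flip₂ = trans (lookup-flipOn b e₂ e₂∈D) (cong₂ (λ x i → x xor lookup b i)
          (bit+bit≡1⇒≡not a (lookup alternating e₂) (trans (sym (degIn-⊆ alternating alternating-⊆)) (alternating-perfect v)))
          (cycleOf-end₁ e₂∈D e₂∋v))
        pointwise : ∀ a c → bit (a xor c) + bit (not a xor c) ≡ 1
        pointwise true  true  = refl
        pointwise true  false = refl
        pointwise false true  = refl
        pointwise false false = refl

      neighbour : Vec Bool N → EdgeSet G
      neighbour b = mutate h (flipOn b)

      private
        anchor : Fin N → Fin m
        anchor i = DEdgesAt.e₁ (dEdgesAt (rep i))

        anchor∈h : ∀ i → lookup h (anchor i) ≡ true
        anchor∈h i = DEdgesAt.e₁∈D (dEdgesAt (rep i))

        cycleOf-anchor : ∀ i → cycleOf (end₁ (anchor i)) ≡ i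
        cycleOf-anchor i = trans (cycleOf-end₁ (anchor∈h i) (DEdgesAt.e₁∋v (dEdgesAt (rep i))))
                                 (Reach-rep⇒≡ _ i (Reach-cycleOf (rep i)))

        lookup-neighbour : ∀ b e → lookup h e ≡ true → lookup (neighbour b) e ≡ lookup alternating e xor lookup b (cycleOf (end₁ e))
        lookup-neighbour b e e∈h = trans (lookup-mutate h (flipOn b) e)
          (trans (cong (λ x → not x ∨ lookup (flipOn b) e) e∈h) (lookup-flipOn b e e∈h))

      neighbour-injective : ∀ {b c} → neighbour b ≡ neighbour c → b ≡ c
      neighbour-injective {b} {c} eq = lookup-extensionality λ i → subst (λ j → lookup b j ≡ lookup c j) (cycleOf-anchor i)
        (xor-cancelˡ (lookup alternating (anchor i))
          (trans (sym (lookup-neighbour b (anchor i) (anchor∈h i)))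
            (trans (cong (λ X → lookup X (anchor i)) eq) (lookup-neighbour c (anchor i) (anchor∈h i)))))

      module _ (F : EdgeSet G) (F⊆h : _⊆ₑ_ G F h) (F-perfect : ∀ v → degIn G F v ≡ 1) where

        -- F and the alternating matching agree on all edges of a cycle, or differ on all of them.
        private
          differs : Fin m → Bool
          differs e = lookup F e xor lookup alternating e

          differs-at-vertex : ∀ {v g g'} → lookup h g ≡ true → lookup h g' ≡ true →
                              incident G g v ≡ true → incident G g' v ≡ true → differs g ≡ differs g'
          differs-at-vertex {v} {g} {g'} g∈h g'∈h g∋v g'∋v with g ≟ g'
          ... | yes refl = refl
          ... | no g≢g' = sym (trans (cong₂ _xor_ (opposite F F⊆h F-perfect) (opposite alternating alternating-⊆ alternating-perfect))
                                     (xor-annihilates-not (lookup F g) (lookup alternating g)))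
            where
            opposite : ∀ M → _⊆ₑ_ G M h → (∀ v → degIn G M v ≡ 1) → lookup M g' ≡ not (lookup M g)
            opposite M M⊆h M-perfect = bit+bit≡1⇒≡not (lookup M g) (lookup M g')
              (trans (sym (degIn-⊆-pair g≢g' g∈h g'∈h g∋v g'∋v M M⊆h)) (M-perfect v))

          differs-Reach : ∀ {u w} → Reach G h u w → ∀ {g g'} → lookup h g ≡ true → incident G g u ≡ true →
                          lookup h g' ≡ true → incident G g' w ≡ true → differs g ≡ differs g'
          differs-Reach here g∈h g∋u g'∈h g'∋w = differs-at-vertex g∈h g'∈h g∋u g'∋w
          differs-Reach (step e e∈h e⇒ rest) g∈h g∋u g'∈h g'∋w = trans
            (differs-at-vertex g∈h e∈h g∋u (Joins⇒incident e⇒))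
            (differs-Reach rest e∈h (Joins⇒incident (Joins-sym e⇒)) g'∈h g'∋w)

        flips : Vec Bool N
        flips = tabulate (λ i → differs (anchor i))

        mutate≡neighbour : mutate h F ≡ neighbour flips
        mutate≡neighbour = lookup-extensionality pointwise
          where
          pointwise : ∀ e → lookup (mutate h F) e ≡ lookup (neighbour flips) e
          pointwise e with lookup h e in e∈h
          ... | false = trans (lookup-mutate h F e) (trans (cong (λ x → not x ∨ lookup F e) e∈h)
                          (sym (trans (lookup-mutate h (flipOn flips) e) (cong (λ x → not x ∨ lookup (flipOn flips) e) e∈h))))
          ... | true = begin
            lookup (mutate h F) e                                   ≡⟨ lookup-mutate h F e ⟩
            not (lookup h e) ∨ lookup F e                           ≡⟨ cong (λ x → not x ∨ lookup F e) e∈h ⟩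
            lookup F e                                              ≡⟨ xor-restore (lookup F e) (lookup alternating e) ⟩
            lookup alternating e xor differs e                      ≡⟨ cong (lookup alternating e xor_) same-cycle ⟩
            lookup alternating e xor differs (anchor i)             ≡⟨ cong (lookup alternating e xor_) (lookup∘tabulate _ i) ⟨
            lookup alternating e xor lookup flips i                 ≡⟨ lookup-neighbour flips e e∈h ⟨
            lookup (neighbour flips) e                              ∎
            where
            open ≡-Reasoning
            i : Fin N
            i = cycleOf (end₁ e)
            same-cycle : differs e ≡ differs (anchor i)
            same-cycle = sym (differs-Reach (Reach-cycleOf (end₁ e)) (anchor∈h i) (DEdgesAt.e₁∋v (dEdgesAt (rep i)))
                                            e∈h (incident-end₁ e))
            xor-restore : ∀ f a → f ≡ a xor (f xor a)
            xor-restore true  true  = refl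
            xor-restore true  false = refl
            xor-restore false true  = refl
            xor-restore false false = refl

      neighbours : List (EdgeSet G)
      neighbours = List.map neighbour (allBoolVecs N)

      ∈-neighbours⇔ : ∀ h' → h' ∈ neighbours ⇔ (WeakHamiltonian G h' × Adj𝔡 G h h')
      ∈-neighbours⇔ h' = mk⇔ to from
        where
        to : h' ∈ neighbours → WeakHamiltonian G h' × Adj𝔡 G h h'
        to h'∈ with ∈-map⁻ neighbour h'∈
        ... | b , _ , refl = mutate-WeakHamiltonian h (flipOn b) (proj₁ h-wh) (flipOn-⊆ b) (flipOn-perfect b) ,
                             inj₁ (flipOn b , flipOn-⊆ b , flipOn-perfect b , refl)
        fromMutation : Mutation G h h' → h' ∈ neighbours
        fromMutation (F , F⊆h , F-perfect , refl) =
          subst (_∈ neighbours) (sym (mutate≡neighbour F F⊆h F-perfect)) (∈-map⁺ neighbour (∈-allBoolVecs N (flips F F⊆h F-perfect)))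
        from : WeakHamiltonian G h' × Adj𝔡 G h h' → h' ∈ neighbours
        from (_ , inj₁ h→h') = fromMutation h→h'
        from (_ , inj₂ h'→h) = fromMutation (Mutation-sym h'→h)

      degree : Degree𝔡 G h (2 ^ N)
      degree = neighbours , Uniqueₚ.map⁺ neighbour-injective (allBoolVecs-unique N) , ∈-neighbours⇔ ,
               trans (length-map neighbour (allBoolVecs N)) (length-allBoolVecs N)

    module _ (v₀ : Fin n) where

      Adj𝔡⇒ChromaticClique : ∀ h₁ h₂ → WeakHamiltonian G h₁ → WeakHamiltonian G h₂ → Adj𝔡 G h₁ h₂ →
                             ∃[ h₃ ] ChromaticClique G h₁ h₂ h₃
      Adj𝔡⇒ChromaticClique h₁ _ wh₁ _ (inj₁ (F , F⊆h₁ , F-perfect , refl)) =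
        _ , chromatic-clique h₁ F v₀ wh₁ F⊆h₁ F-perfect
      Adj𝔡⇒ChromaticClique _ h₂ _ wh₂ (inj₂ (F , F⊆h₂ , F-perfect , refl)) =
        _ , ChromaticClique-swap (chromatic-clique h₂ F v₀ wh₂ F⊆h₂ F-perfect)

      WeakHamiltonian⇒ChromaticClique : ∀ h → WeakHamiltonian G h → ∃[ h₂ ] ∃[ h₃ ] ChromaticClique G h h₂ h₃
      WeakHamiltonian⇒ChromaticClique h wh = _ , _ , chromatic-clique h alternating v₀ wh alternating-⊆ alternating-perfect
        where open AlternatingMatching h wh

    NumCycles⇒Degree𝔡 : ∀ h N → WeakHamiltonian G h → NumCycles G h N → Degree𝔡 G h (2 ^ N)
    NumCycles⇒Degree𝔡 h _ wh (reps , reps-apart , reps-cover , refl) = Neighbourhood.degree h wh reps reps-apart reps-cover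

mainTheorem5 : ∀ {n m} (G : Graph n m) → 0 < n → Cubic G → Bridgeless G → PlaneEmbedding G →
    (∀ h₁ h₂ → WeakHamiltonian G h₁ → WeakHamiltonian G h₂ → Adj𝔡 G h₁ h₂ →
      ∃[ h₃ ] ChromaticClique G h₁ h₂ h₃)
  × (∀ h → WeakHamiltonian G h → ∃[ h₂ ] ∃[ h₃ ] ChromaticClique G h h₂ h₃)
  × (∀ h N → WeakHamiltonian G h → NumCycles G h N → Degree𝔡 G h (2 ^ N))
mainTheorem5 {n} G 0<n cubic _ _ =
  Adj𝔡⇒ChromaticClique G cubic v₀ , WeakHamiltonian⇒ChromaticClique G cubic v₀ , NumCycles⇒Degree𝔡 G cubic
  where
  v₀ : Fin n
  v₀ = Fin.fromℕ< 0<n
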